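{- Let $F$ and $g$ be positive integers such that $g \leq F \leq 2g-1$. Then $$\#\mathcal{E}(F,g) = \binom{\lceil \frac{F}{2}\rceil - 1}{F-g}.$$
   Context: A numerical semigroup is a subset $S \subseteq \mathbb{N}$ (with $\mathbb{N}$ the nonnegative integers) closed under addition, containing $0$, with $\mathbb{N}\setminus S$ finite. The genus of $S$ is $\#(\mathbb{N}\setminus S)$; the Frobenius number $\mathrm{F}(S)$ is the largest integer not in $S$; the multiplicity $\mathrm{m}(S)$ is the least positive integer in $S$. $S$ is called elementary if $\mathrm{F}(S) < 2\,\mathrm{m}(S)$. $\mathcal{E}(F,g)$ denotes the set of elementary numerical semigroups with Frobenius number $F$ and genus $g$. -}

module Defs where

open import Data.Nat using (ℕ; zero; suc; _+_; _*_; _≤_; _<_)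
open import Data.Bool using (Bool; true; false; not)
open import Data.List using (List; length; filter; upTo)
open import Data.Product using (Σ; ∃; _×_; _,_; proj₁)
open import Relation.Binary.PropositionalEquality using (_≡_; refl; sym; trans)
open import Relation.Binary.Bundles using (Setoid)
open import Relation.Nullary.Decidable using (does)
open import Data.Bool.Properties using (_≟_)

Subsetℕ : Set
Subsetℕ = ℕ → Bool

_∈_ : ℕ → Subsetℕ → Set
n ∈ S = S n ≡ true

_∉_ : ℕ → Subsetℕ → Set
n ∉ S = S n ≡ false

record IsNumericalSemigroup (S : Subsetℕ) : Set where
  field
    zero∈   : 0 ∈ S
    +-closed : ∀ a b → a ∈ S → b ∈ S → (a + b) ∈ S
    cofinite : ∃ λ N → ∀ n → N ≤ n → n ∈ S

IsFrobenius : Subsetℕ → ℕ → Set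
IsFrobenius S F = F ∉ S × (∀ n → F < n → n ∈ S)

gapsUpTo : Subsetℕ → ℕ → List ℕ
gapsUpTo S F = filter (λ n → S n ≟ false) (upTo (suc F))

-- Genus of S, given that F is its Frobenius number: #(ℕ ∖ S).
genus : Subsetℕ → ℕ → ℕ
genus S F = length (gapsUpTo S F)

IsMultiplicity : Subsetℕ → ℕ → Set
IsMultiplicity S m = 0 < m × m ∈ S × (∀ k → 0 < k → k < m → k ∉ S)

IsElementary : Subsetℕ → ℕ → Set
IsElementary S F = ∃ λ m → IsMultiplicity S m × F < 2 * m

record ElemNS (F g : ℕ) : Set where
  field
    S          : Subsetℕ
    isNS       : IsNumericalSemigroup S
    frobenius  : IsFrobenius S F
    genus≡     : genus S F ≡ g
    elementary : IsElementary S F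

𝓔 : ℕ → ℕ → Setoid _ _
𝓔 F g = record
  { Carrier = ElemNS F g
  ; _≈_ = λ A B → ∀ n → ElemNS.S A n ≡ ElemNS.S B n
  ; isEquivalence = record
    { refl = λ n → refl
    ; sym = λ p n → sym (p n)
    ; trans = λ p q n → trans (p n) (q n)
    }
  }

-- If F < 2 m(S), then 1, …, ⌊F/2⌋ are gaps (each is below the multiplicity), F is a gap and
-- every x > F lies in S, so S is determined by which of the ⌈F/2⌉ − 1 numbers strictly
-- between ⌊F/2⌋ and F it contains. Conversely every choice works: the sum of two positive
-- elements exceeds F. The genus is ⌊F/2⌋ + 1 plus the number of omitted middle numbers,
-- so fixing it to g fixes the size of the chosen set to F − g.

module Submission where

open import Defs
open import Data.Bool using (Bool; true; false)
open import Data.Bool.Properties using (_≟_)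
open import Data.Fin using (Fin; zero; splitAt; _↑ˡ_; _↑ʳ_)
open import Data.Fin.Properties using (splitAt-↑ˡ; splitAt-↑ʳ; splitAt⁻¹-↑ˡ; splitAt⁻¹-↑ʳ)
open import Data.Fin.Subset using (Subset; ∣_∣; inside; outside) renaming (⊥ to ∅)
open import Data.Fin.Subset.Properties using (∣⊥∣≡0)
open import Data.List using (List; []; _∷_; _++_; length; filter; applyUpTo; replicate)
open import Data.List.Properties using (length-++; length-replicate; filter-++)
open import Data.Nat using (ℕ; zero; suc; _+_; _*_; _∸_; _≤_; _<_; z≤n; s≤s; ⌊_/2⌋; ⌈_/2⌉)
open import Data.Nat.Combinatorics using (_C_; nCk+nC[k+1]≡[n+1]C[k+1])
open import Data.Nat.Properties hiding (_≟_)
open import Data.Product using (Σ; _,_; proj₁; proj₂)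
open import Data.Sum using (_⊎_; inj₁; inj₂)
open import Data.Vec using (Vec; []; _∷_; toList)
open import Data.Vec.Properties using (length-toList)
open import Function.Base using (_∘_)
open import Function.Bundles using (Bijection; Inverse)
open import Function.Properties.Inverse using (Inverse⇒Bijection)
import Function.Construct.Composition as Compose
open import Relation.Binary using (Setoid; tri<; tri≈; tri>)
import Relation.Binary.Construct.On as On
open import Relation.Binary.PropositionalEquality
  using (_≡_; _≗_; refl; sym; trans; cong; cong₂; subst; setoid; module ≡-Reasoning)
open import Relation.Nullary using (yes; no)

-- k-subsets of an n-set

-- Pascal's rule as the definition makes ranking a k-subset by its first bit structural.
binomial : ℕ → ℕ → ℕ
binomial zero    zero    = 1
binomial zero    (suc k) = 0
binomial (suc n) zero    = 1
binomial (suc n) (suc k) = binomial n k + binomial n (suc k)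

binomial≡C : ∀ n k → binomial n k ≡ n C k
binomial≡C zero    zero    = refl
binomial≡C zero    (suc k) = refl
binomial≡C (suc n) zero    = refl
binomial≡C (suc n) (suc k) =
  trans (cong₂ _+_ (binomial≡C n k) (binomial≡C n (suc k))) (nCk+nC[k+1]≡[n+1]C[k+1] n k)

SubsetOfSize : ℕ → ℕ → Set
SubsetOfSize n k = Σ (Subset n) (λ p → ∣ p ∣ ≡ k)

subsetsOfSize : ℕ → ℕ → Setoid _ _
subsetsOfSize n k = On.setoid {B = SubsetOfSize n k} (setoid (Subset n)) proj₁

∣p∣≡0⇒p≡∅ : ∀ {n} (p : Subset n) → ∣ p ∣ ≡ 0 → p ≡ ∅
∣p∣≡0⇒p≡∅ []            _ = refl
∣p∣≡0⇒p≡∅ (inside  ∷ p) ()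
∣p∣≡0⇒p≡∅ (outside ∷ p) e = cong (outside ∷_) (∣p∣≡0⇒p≡∅ p e)

rank : ∀ n k (p : Subset n) → ∣ p ∣ ≡ k → Fin (binomial n k)
rank zero    zero    []            _ = zero
rank zero    (suc k) []            ()
rank (suc n) zero    _             _ = zero
rank (suc n) (suc k) (inside  ∷ p) e = rank n k p (suc-injective e) ↑ˡ binomial n (suc k)
rank (suc n) (suc k) (outside ∷ p) e = binomial n k ↑ʳ rank n (suc k) p e

rank-irrelevant : ∀ n k {p q : Subset n} (e : ∣ p ∣ ≡ k) (e′ : ∣ q ∣ ≡ k) →
                  p ≡ q → rank n k p e ≡ rank n k q e′
rank-irrelevant n k {p} e e′ refl = cong (rank n k p) (≡-irrelevant e e′)

unrank : ∀ n k → Fin (binomial n k) → SubsetOfSize n k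
unrank zero    zero    _ = [] , refl
unrank zero    (suc k) ()
unrank (suc n) zero    _ = ∅ , ∣⊥∣≡0 (suc n)
unrank (suc n) (suc k) i with splitAt (binomial n k) i
... | inj₁ a = let p , e = unrank n k a       in inside  ∷ p , cong suc e
... | inj₂ b = let p , e = unrank n (suc k) b in outside ∷ p , e

unrank-rank : ∀ n k (p : Subset n) (e : ∣ p ∣ ≡ k) → proj₁ (unrank n k (rank n k p e)) ≡ p
unrank-rank zero    zero    []            _ = refl
unrank-rank zero    (suc k) []            ()
unrank-rank (suc n) zero    p             e = sym (∣p∣≡0⇒p≡∅ p e)
unrank-rank (suc n) (suc k) (inside ∷ p)  e
  rewrite splitAt-↑ˡ (binomial n k) (rank n k p (suc-injective e)) (binomial n (suc k))
  = cong (inside ∷_) (unrank-rank n k p (suc-injective e))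
unrank-rank (suc n) (suc k) (outside ∷ p) e
  rewrite splitAt-↑ʳ (binomial n k) (binomial n (suc k)) (rank n (suc k) p e)
  = cong (outside ∷_) (unrank-rank n (suc k) p e)

rank-unrank : ∀ n k i (e : ∣ proj₁ (unrank n k i) ∣ ≡ k) → rank n k (proj₁ (unrank n k i)) e ≡ i
rank-unrank zero    zero    zero _ = refl
rank-unrank zero    (suc k) ()
rank-unrank (suc n) zero    zero _ = refl
rank-unrank (suc n) (suc k) i    _ with splitAt (binomial n k) i in eq
... | inj₁ a = trans (cong (_↑ˡ binomial n (suc k)) (rank-unrank n k a _)) (splitAt⁻¹-↑ˡ eq)
... | inj₂ b = trans (cong (binomial n k ↑ʳ_) (rank-unrank n (suc k) b _)) (splitAt⁻¹-↑ʳ eq)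

subsetsOfSize↔Fin : ∀ n k → Inverse (subsetsOfSize n k) (setoid (Fin (n C k)))
subsetsOfSize↔Fin n k = subst (λ c → Inverse (subsetsOfSize n k) (setoid (Fin c))) (binomial≡C n k) record
  { to        = λ (p , e) → rank n k p e
  ; from      = unrank n k
  ; to-cong   = λ {(_ , e)} {(_ , e′)} → rank-irrelevant n k e e′
  ; from-cong = cong (proj₁ ∘ unrank n k)
  ; inverse   = (λ {i} {(_ , e)} p≡ → trans (rank-irrelevant n k e (proj₂ (unrank n k i)) p≡) (rank-unrank n k i _))
              , (λ {(p , e)} {i} i≡ → trans (cong (proj₁ ∘ unrank n k) i≡) (unrank-rank n k p e))
  }

-- Subsets of ℕ given by a finite prefix of their characteristic sequence

fromPrefix : List Bool → Subsetℕ
fromPrefix []      _       = true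
fromPrefix (b ∷ L) zero    = b
fromPrefix (b ∷ L) (suc x) = fromPrefix L x

fromPrefix-beyond : ∀ L {x} → length L ≤ x → fromPrefix L x ≡ true
fromPrefix-beyond []      _         = refl
fromPrefix-beyond (b ∷ L) (s≤s L≤x) = fromPrefix-beyond L L≤x

fromPrefix-replicate : ∀ h L {x} → x < h → fromPrefix (replicate h false ++ L) x ≡ false
fromPrefix-replicate (suc h) L {zero}  _         = refl
fromPrefix-replicate (suc h) L {suc x} (s≤s x<h) = fromPrefix-replicate h L x<h

fromPrefix-replicate-+ : ∀ h L j → fromPrefix (replicate h false ++ L) (h + j) ≡ fromPrefix L j
fromPrefix-replicate-+ zero    L j = refl
fromPrefix-replicate-+ (suc h) L j = fromPrefix-replicate-+ h L j

fromPrefix-toList-∷ : ∀ {n} (v : Vec Bool n) b L → fromPrefix (toList v ++ b ∷ L) n ≡ b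
fromPrefix-toList-∷ []      b L = refl
fromPrefix-toList-∷ (c ∷ v) b L = fromPrefix-toList-∷ v b L

tabulateℕ : (ℕ → Bool) → ∀ n → Vec Bool n
tabulateℕ f zero    = []
tabulateℕ f (suc n) = f zero ∷ tabulateℕ (f ∘ suc) n

tabulateℕ-cong : ∀ {f f′} n → f ≗ f′ → tabulateℕ f n ≡ tabulateℕ f′ n
tabulateℕ-cong zero    _    = refl
tabulateℕ-cong (suc n) f≗f′ = cong₂ _∷_ (f≗f′ zero) (tabulateℕ-cong n (f≗f′ ∘ suc))

tabulateℕ-fromPrefix : ∀ {n} (v : Vec Bool n) L → tabulateℕ (fromPrefix (toList v ++ L)) n ≡ v
tabulateℕ-fromPrefix []      L = refl
tabulateℕ-fromPrefix (b ∷ v) L = cong (b ∷_) (tabulateℕ-fromPrefix v L)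

fromPrefix-tabulateℕ : ∀ f n L {j} → j < n → fromPrefix (toList (tabulateℕ f n) ++ L) j ≡ f j
fromPrefix-tabulateℕ f (suc n) L {zero}  _         = refl
fromPrefix-tabulateℕ f (suc n) L {suc j} (s≤s j<n) = fromPrefix-tabulateℕ (f ∘ suc) n L j<n

firstTrue : List Bool → ℕ
firstTrue []          = 0
firstTrue (true  ∷ L) = 0
firstTrue (false ∷ L) = suc (firstTrue L)

fromPrefix-firstTrue : ∀ L → fromPrefix L (firstTrue L) ≡ true
fromPrefix-firstTrue []          = refl
fromPrefix-firstTrue (true  ∷ L) = refl
fromPrefix-firstTrue (false ∷ L) = fromPrefix-firstTrue L

fromPrefix-<firstTrue : ∀ L {j} → j < firstTrue L → fromPrefix L j ≡ false
fromPrefix-<firstTrue (false ∷ L) {zero}  _         = refl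
fromPrefix-<firstTrue (false ∷ L) {suc j} (s≤s j<t) = fromPrefix-<firstTrue L j<t

firstTrue-replicate : ∀ h L → firstTrue (replicate h false ++ L) ≡ h + firstTrue L
firstTrue-replicate zero    L = refl
firstTrue-replicate (suc h) L = cong suc (firstTrue-replicate h L)

multiplicity-fromPrefix : ∀ L → IsMultiplicity (fromPrefix (true ∷ L)) (suc (firstTrue L))
multiplicity-fromPrefix L = s≤s z≤n , fromPrefix-firstTrue L , below
  where
  below : ∀ x → 0 < x → x < suc (firstTrue L) → fromPrefix (true ∷ L) x ≡ false
  below (suc x) _ (s≤s x<t) = fromPrefix-<firstTrue L x<t

falses : List Bool → ℕ
falses = length ∘ filter (_≟ false)

falses-++ : ∀ xs ys → falses (xs ++ ys) ≡ falses xs + falses ys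
falses-++ xs ys = trans (cong length (filter-++ (_≟ false) xs ys)) (length-++ (filter (_≟ false) xs))

falses-replicate : ∀ h → falses (replicate h false) ≡ h
falses-replicate zero    = refl
falses-replicate (suc h) = cong suc (falses-replicate h)

falses+∣p∣≡n : ∀ {n} (p : Subset n) → falses (toList p) + ∣ p ∣ ≡ n
falses+∣p∣≡n []            = refl
falses+∣p∣≡n (inside  ∷ p) = trans (+-suc _ _) (cong suc (falses+∣p∣≡n p))
falses+∣p∣≡n (outside ∷ p) = cong suc (falses+∣p∣≡n p)

genus≡falses : ∀ S F → genus S F ≡ falses (applyUpTo S (suc F))
genus≡falses S F = gaps-applyUpTo (λ x → x) (suc F)
  where
  gaps-applyUpTo : ∀ f m → length (filter (λ x → S x ≟ false) (applyUpTo f m))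
                           ≡ falses (applyUpTo (S ∘ f) m)
  gaps-applyUpTo f zero    = refl
  gaps-applyUpTo f (suc m) with S (f zero)
  ... | true  = gaps-applyUpTo (f ∘ suc) m
  ... | false = cong suc (gaps-applyUpTo (f ∘ suc) m)

applyUpTo-cong : ∀ {f f′ : ℕ → Bool} m → f ≗ f′ → applyUpTo f m ≡ applyUpTo f′ m
applyUpTo-cong zero    _    = refl
applyUpTo-cong (suc m) f≗f′ = cong₂ _∷_ (f≗f′ zero) (applyUpTo-cong m (f≗f′ ∘ suc))

genus-cong : ∀ {S T} F → S ≗ T → genus S F ≡ genus T F
genus-cong {S} {T} F S≗T = begin
  genus S F                         ≡⟨ genus≡falses S F ⟩
  falses (applyUpTo S (suc F))      ≡⟨ cong falses (applyUpTo-cong (suc F) S≗T) ⟩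
  falses (applyUpTo T (suc F))      ≡⟨ genus≡falses T F ⟨
  genus T F                         ∎
  where open ≡-Reasoning

applyUpTo-fromPrefix : ∀ L → applyUpTo (fromPrefix L) (length L) ≡ L
applyUpTo-fromPrefix []      = refl
applyUpTo-fromPrefix (b ∷ L) = cong (b ∷_) (applyUpTo-fromPrefix L)

genus-fromPrefix : ∀ L F → length L ≡ suc F → genus (fromPrefix L) F ≡ falses L
genus-fromPrefix L F ∣L∣≡1+F = begin
  genus (fromPrefix L) F                        ≡⟨ genus≡falses (fromPrefix L) F ⟩
  falses (applyUpTo (fromPrefix L) (suc F))     ≡⟨ cong (falses ∘ applyUpTo (fromPrefix L)) ∣L∣≡1+F ⟨
  falses (applyUpTo (fromPrefix L) (length L))  ≡⟨ cong falses (applyUpTo-fromPrefix L) ⟩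
  falses L                                      ∎
  where open ≡-Reasoning

-- Elementary numerical semigroups

elementary-gap : ∀ {S F x} → IsElementary S F → 0 < x → 2 * x ≤ F → x ∉ S
elementary-gap (_ , (_ , _ , below) , F<2m) 0<x 2x≤F =
  below _ 0<x (*-cancelˡ-< 2 _ _ (≤-<-trans 2x≤F F<2m))

+-closed-above-half : ∀ {S F a} → F < 2 * a → (∀ x → F < x → x ∈ S) →
                      (∀ x → x ∈ S → x ≡ 0 ⊎ a ≤ x) →
                      ∀ x y → x ∈ S → y ∈ S → (x + y) ∈ S
+-closed-above-half {S} {a = a} F<2a above small-or-large x y x∈S y∈S
  with small-or-large x x∈S | small-or-large y y∈S
... | inj₁ refl | _         = y∈S
... | inj₂ _    | inj₁ refl = subst (_∈ S) (sym (+-identityʳ x)) x∈S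
... | inj₂ a≤x  | inj₂ a≤y  =
  above (x + y) (<-≤-trans F<2a (+-mono-≤ a≤x (≤-trans (≤-reflexive (+-identityʳ a)) a≤y)))

module ElementaryShape (h n : ℕ) (n≤h : n ≤ h) (h≤1+n : h ≤ suc n) where

  F : ℕ
  F = suc (h + n)

  data Position : ℕ → Set where
    origin    : Position 0
    small     : ∀ {x} → x < h → Position (suc x)
    middle    : ∀ {j} → j < n → Position (suc (h + j))
    atF       : Position F
    beyond    : ∀ {x} → F < x → Position x

  position : ∀ x → Position x
  position zero = origin
  position (suc x) with x <? h
  ... | yes x<h = small x<h
  ... | no  x≮h with j , refl ← m≤n⇒∃[o]m+o≡n (≮⇒≥ x≮h) with <-cmp j n
  ...   | tri< j<n _ _ = middle j<n
  ...   | tri≈ _ refl _ = atF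
  ...   | tri> _ _ n<j = beyond (s≤s (+-monoʳ-< h n<j))

  2h≤F : 2 * h ≤ F
  2h≤F = begin
    h + (h + 0) ≡⟨ cong (h +_) (+-identityʳ h) ⟩
    h + h       ≤⟨ +-monoʳ-≤ h h≤1+n ⟩
    h + suc n   ≡⟨ +-suc h n ⟩
    F           ∎
    where open ≤-Reasoning

  F<2m : ∀ {m} → h < m → F < 2 * m
  F<2m h<m = <-≤-trans (s≤s (+-monoʳ-< h (s≤s (≤-trans n≤h (≤-reflexive (sym (+-identityʳ h)))))))
                       (*-monoʳ-≤ 2 h<m)

  -- shape p = {0} ∪ {1 + h + j ∣ j ∈ p} ∪ {x ∣ F < x}
  shapePrefix : Subset n → List Bool
  shapePrefix p = true ∷ replicate h false ++ toList p ++ false ∷ []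

  shape : Subset n → Subsetℕ
  shape = fromPrefix ∘ shapePrefix

  window : Subsetℕ → Subset n
  window S = tabulateℕ (λ j → S (suc (h + j))) n

  window-cong : ∀ {S T} → S ≗ T → window S ≡ window T
  window-cong S≗T = tabulateℕ-cong n (S≗T ∘ suc ∘ (h +_))

  module _ (p : Subset n) where

    shape-small : ∀ {x} → x < h → shape p (suc x) ≡ false
    shape-small = fromPrefix-replicate h (toList p ++ false ∷ [])

    shape-middle : ∀ j → shape p (suc (h + j)) ≡ fromPrefix (toList p ++ false ∷ []) j
    shape-middle = fromPrefix-replicate-+ h (toList p ++ false ∷ [])

    shape-frobenius : shape p F ≡ false
    shape-frobenius = trans (shape-middle n) (fromPrefix-toList-∷ p false [])

    length-shapePrefix : length (shapePrefix p) ≡ suc F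
    length-shapePrefix = cong suc (begin
      length (replicate h false ++ toList p ++ false ∷ [])        ≡⟨ length-++ (replicate h false) ⟩
      length (replicate h false) + length (toList p ++ false ∷ []) ≡⟨ cong₂ _+_ (length-replicate h)
                                                                       (length-++ (toList p)) ⟩
      h + (length (toList p) + 1)                                  ≡⟨ cong (λ l → h + (l + 1)) (length-toList p) ⟩
      h + (n + 1)                                                  ≡⟨ cong (h +_) (+-comm n 1) ⟩
      h + suc n                                                    ≡⟨ +-suc h n ⟩
      F                                                            ∎)
      where open ≡-Reasoning

    shape-beyond : ∀ {x} → F < x → shape p x ≡ true
    shape-beyond F<x = fromPrefix-beyond (shapePrefix p) (≤-trans (≤-reflexive length-shapePrefix) F<x)

    shape-zero-or-large : ∀ x → x ∈ shape p → x ≡ 0 ⊎ suc h ≤ x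
    shape-zero-or-large x x∈ with position x
    ... | origin       = inj₁ refl
    ... | small x<h    with () ← trans (sym x∈) (shape-small x<h)
    ... | middle {j} _ = inj₂ (s≤s (m≤m+n h j))
    ... | atF          = inj₂ (s≤s (m≤m+n h n))
    ... | beyond F<x   = inj₂ (≤-trans (s≤s (m≤m+n h n)) (<⇒≤ F<x))

    shape-isNumericalSemigroup : IsNumericalSemigroup (shape p)
    shape-isNumericalSemigroup = record
      { zero∈    = refl
      ; +-closed = +-closed-above-half (F<2m ≤-refl) (λ _ → shape-beyond) shape-zero-or-large
      ; cofinite = suc F , λ _ → shape-beyond
      }

    shape-isFrobenius : IsFrobenius (shape p) F
    shape-isFrobenius = shape-frobenius , λ _ → shape-beyond

    shape-isElementary : IsElementary (shape p) F
    shape-isElementary = suc (firstTrue L) , multiplicity-fromPrefix L , F<2m h<m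
      where
      L = replicate h false ++ toList p ++ false ∷ []
      h<m : h < suc (firstTrue L)
      h<m = s≤s (≤-trans (m≤m+n h _) (≤-reflexive (sym (firstTrue-replicate h _))))

    falses-shapePrefix : falses (shapePrefix p) ≡ suc (h + falses (toList p))
    falses-shapePrefix = begin
      falses (replicate h false ++ toList p ++ false ∷ [])            ≡⟨ falses-++ (replicate h false) _ ⟩
      falses (replicate h false) + falses (toList p ++ false ∷ [])    ≡⟨ cong₂ _+_ (falses-replicate h)
                                                                          (falses-++ (toList p) _) ⟩
      h + (falses (toList p) + 1)                                     ≡⟨ cong (h +_) (+-comm _ 1) ⟩
      h + suc (falses (toList p))                                     ≡⟨ +-suc h _ ⟩
      suc (h + falses (toList p))                                     ∎
      where open ≡-Reasoning

    genus-shape+∣p∣≡F : genus (shape p) F + ∣ p ∣ ≡ F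
    genus-shape+∣p∣≡F = begin
      genus (shape p) F + ∣ p ∣               ≡⟨ cong (_+ ∣ p ∣) (genus-fromPrefix (shapePrefix p) F length-shapePrefix) ⟩
      falses (shapePrefix p) + ∣ p ∣          ≡⟨ cong (_+ ∣ p ∣) falses-shapePrefix ⟩
      suc (h + falses (toList p) + ∣ p ∣)     ≡⟨ cong suc (+-assoc h _ _) ⟩
      suc (h + (falses (toList p) + ∣ p ∣))   ≡⟨ cong (suc ∘ (h +_)) (falses+∣p∣≡n p) ⟩
      F                                       ∎
      where open ≡-Reasoning

  window-shape : ∀ p → window (shape p) ≡ p
  window-shape p = trans (tabulateℕ-cong n (shape-middle p)) (tabulateℕ-fromPrefix p (false ∷ []))

  shape-window : ∀ {S} → IsNumericalSemigroup S → IsFrobenius S F → IsElementary S F →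
                 shape (window S) ≗ S
  shape-window {S} isNS (F∉S , above) elem x with position x
  ... | origin         = sym (IsNumericalSemigroup.zero∈ isNS)
  ... | small x<h      = trans (shape-small _ x<h)
                               (sym (elementary-gap elem (s≤s z≤n) (≤-trans (*-monoʳ-≤ 2 x<h) 2h≤F)))
  ... | middle {j} j<n = trans (shape-middle _ j)
                               (fromPrefix-tabulateℕ (λ j → S (suc (h + j))) n (false ∷ []) j<n)
  ... | atF            = trans (shape-frobenius _) (sym F∉S)
  ... | beyond F<x     = trans (shape-beyond _ F<x) (sym (above _ F<x))

  module _ (g : ℕ) (g≤F : g ≤ F) where

    window-size : (E : ElemNS F g) → ∣ window (ElemNS.S E) ∣ ≡ F ∸ g
    window-size E = begin
      ∣ p ∣                          ≡⟨ m+n∸m≡n g ∣ p ∣ ⟨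
      g + ∣ p ∣ ∸ g                  ≡⟨ cong (λ γ → γ + ∣ p ∣ ∸ g) genus-shape≡g ⟨
      genus (shape p) F + ∣ p ∣ ∸ g  ≡⟨ cong (_∸ g) (genus-shape+∣p∣≡F p) ⟩
      F ∸ g                          ∎
      where
      open ≡-Reasoning
      open ElemNS E
      p = window S
      genus-shape≡g : genus (shape p) F ≡ g
      genus-shape≡g = trans (genus-cong F (shape-window isNS frobenius elementary)) genus≡

    genus-shape : ∀ p → ∣ p ∣ ≡ F ∸ g → genus (shape p) F ≡ g
    genus-shape p ∣p∣≡F∸g = ∸-cancelˡ-≡ γ≤F g≤F (begin
      F ∸ γ              ≡⟨ cong (_∸ γ) (genus-shape+∣p∣≡F p) ⟨
      γ + ∣ p ∣ ∸ γ      ≡⟨ m+n∸m≡n γ ∣ p ∣ ⟩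
      ∣ p ∣              ≡⟨ ∣p∣≡F∸g ⟩
      F ∸ g              ∎)
      where
      open ≡-Reasoning
      γ = genus (shape p) F
      γ≤F : γ ≤ F
      γ≤F = subst (γ ≤_) (genus-shape+∣p∣≡F p) (m≤m+n γ ∣ p ∣)

    toElemNS : SubsetOfSize n (F ∸ g) → ElemNS F g
    toElemNS (p , ∣p∣≡F∸g) = record
      { S          = shape p
      ; isNS       = shape-isNumericalSemigroup p
      ; frobenius  = shape-isFrobenius p
      ; genus≡     = genus-shape p ∣p∣≡F∸g
      ; elementary = shape-isElementary p
      }

    𝓔↔subsetsOfSize : Inverse (𝓔 F g) (subsetsOfSize n (F ∸ g))
    𝓔↔subsetsOfSize = record
      { to        = λ E → window (ElemNS.S E) , window-size E
      ; from      = toElemNS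
      ; to-cong   = window-cong
      ; from-cong = λ p≡q x → cong (λ p → shape p x) p≡q
      ; inverse   = (λ {(p , _)} E≈ → trans (window-cong E≈) (window-shape p))
                  , (λ {E} p≡ x → trans (cong (λ p → shape p x) p≡)
                                        (shape-window (ElemNS.isNS E) (ElemNS.frobenius E) (ElemNS.elementary E) x))
      }

⌈n/2⌉≤1+⌊n/2⌋ : ∀ n → ⌈ n /2⌉ ≤ suc ⌊ n /2⌋
⌈n/2⌉≤1+⌊n/2⌋ zero          = z≤n
⌈n/2⌉≤1+⌊n/2⌋ (suc zero)    = s≤s z≤n
⌈n/2⌉≤1+⌊n/2⌋ (suc (suc n)) = s≤s (⌈n/2⌉≤1+⌊n/2⌋ n)

corollary4 : (F g : ℕ) → 1 ≤ g → 1 ≤ F → g ≤ F → F ≤ 2 * g ∸ 1 →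
    Bijection (𝓔 F g) (setoid (Fin ((⌈ F /2⌉ ∸ 1) C (F ∸ g))))
corollary4 (suc m) g _ _ g≤F _ =
  subst (λ F′ → Bijection (𝓔 F′ g) (setoid (Fin (n C (F′ ∸ g))))) F≡1+m
    (Inverse⇒Bijection (Compose.inverse (𝓔↔subsetsOfSize g (subst (g ≤_) (sym F≡1+m) g≤F))
                                          (subsetsOfSize↔Fin n (F ∸ g))))
  where
  h = ⌈ m /2⌉
  n = ⌊ m /2⌋
  open ElementaryShape h n (⌊n/2⌋≤⌈n/2⌉ m) (⌈n/2⌉≤1+⌊n/2⌋ m)
  F≡1+m : F ≡ suc m
  F≡1+m = cong suc (trans (+-comm h n) (⌊n/2⌋+⌈n/2⌉≡n m))
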